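{- For each Alternating pushdown system $\mathcal{I}$ there exist an inference system $\hat{\mathcal{I}}$ equivalent to $\mathcal{I}$ and a finite set $\mathcal{C}$ of atomic propositions such that the conclusions of the rules of $\hat{\mathcal{I}}$ are in $\mathcal{C}$, and for every closed atomic proposition $A$ there exists a unique proposition $B$ in $\mathcal{C}$ such that $A$ is an instance of $B$.
   Context: Consider a language with finitely many unary predicate symbols, finitely many unary function symbols, and a constant $\varepsilon$; write $a\,t$ for $a(t)$. Closed atomic propositions are $P(t)$ with $t$ a closed term; these form the set of propositions. Rules are given as schemata in one variable $x$: a schema with premises $A_1,\dots,A_n$ and conclusion $B$ (atomic propositions possibly containing $x$) stands for all its closed instances, i.e. for each closed term $t$, $B[t/x]$ is derivable from $\langle A_1[t/x],\dots,A_n[t/x]\rangle$. An Alternating pushdown system is an inference system whose rules are schemata of the following forms, where all premises in a rule are distinct, $P_i,Q$ are predicate symbols and $a$ a function symbol: intro: premises $P_1(x),\dots,P_n(x)$, conclusion $Q(a\,x)$, $n\ge0$; elimination: premises $P_1(a\,x),P_2(x),\dots,P_n(x)$, conclusion $Q(x)$, $n\ge1$; arbitrary: no premises, conclusion $Q(x)$; neutral: premises $P_1(x),\dots,P_n(x)$, conclusion $Q(x)$, $n\ge1$; empty: no premises, conclusion $Q(\varepsilon)$. A finite proof is a finite tree labeled with closed propositions where each node is derivable from its children (in order) by a rule instance. Two systems are equivalent if the same propositions have finite proofs in them. -}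

module Defs where

open import Data.Nat using (ℕ)
open import Data.Fin using (Fin)
open import Data.List using (List; []; _∷_; map)
open import Data.List.Relation.Unary.All using (All)
open import Data.List.Relation.Unary.Unique.Propositional using (Unique)
open import Data.List.Membership.Propositional using (_∈_)
open import Data.Product using (Σ; _×_; _,_)
open import Relation.Binary.PropositionalEquality using (_≡_)

data CTerm (nf : ℕ) : Set where
  ε   : CTerm nf
  app : Fin nf → CTerm nf → CTerm nf

data OTerm (nf : ℕ) : Set where
  var : OTerm nf
  eps : OTerm nf
  app : Fin nf → OTerm nf → OTerm nf

substT : {nf : ℕ} → OTerm nf → CTerm nf → CTerm nf
substT var       u = u
substT eps       u = ε
substT (app a t) u = app a (substT t u)

record CAtom (np nf : ℕ) : Set where
  constructor catom
  field
    pred : Fin np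
    arg  : CTerm nf

record OAtom (np nf : ℕ) : Set where
  constructor oatom
  field
    pred : Fin np
    arg  : OTerm nf

substA : {np nf : ℕ} → OAtom np nf → CTerm nf → CAtom np nf
substA (oatom P t) u = catom P (substT t u)

IsInstance : {np nf : ℕ} → CAtom np nf → OAtom np nf → Set
IsInstance {nf = nf} A B = Σ (CTerm nf) λ t → substA B t ≡ A

record Rule (np nf : ℕ) : Set where
  constructor rule
  field
    premises   : List (OAtom np nf)
    conclusion : OAtom np nf

InferenceSystem : ℕ → ℕ → Set₁
InferenceSystem np nf = Rule np nf → Set

data Provable {np nf : ℕ} (S : InferenceSystem np nf) : CAtom np nf → Set where
  node : (r : Rule np nf) → S r → (t : CTerm nf) →
         All (Provable S) (map (λ A → substA A t) (Rule.premises r)) →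
         Provable S (substA (Rule.conclusion r) t)

Equivalent : {np nf : ℕ} → InferenceSystem np nf → InferenceSystem np nf → Set
Equivalent {np} {nf} S S' =
  (A : CAtom np nf) → (Provable S A → Provable S' A) × (Provable S' A → Provable S A)

atX : {np nf : ℕ} → Fin np → OAtom np nf
atX P = oatom P var

data IsAPSRule {np nf : ℕ} : Rule np nf → Set where
  intro   : (Ps : List (Fin np)) (Q : Fin np) (a : Fin nf) →
            Unique (map (atX {nf = nf}) Ps) →
            IsAPSRule (rule (map (atX {nf = nf}) Ps) (oatom Q (app a var)))
  elim    : (P₁ : Fin np) (a : Fin nf) (Ps : List (Fin np)) (Q : Fin np) →
            Unique (oatom P₁ (app a var) ∷ map (atX {nf = nf}) Ps) →
            IsAPSRule (rule (oatom P₁ (app a var) ∷ map (atX {nf = nf}) Ps) (atX Q))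
  arbitrary : (Q : Fin np) → IsAPSRule (rule [] (atX Q))
  neutral : (P₁ : Fin np) (Ps : List (Fin np)) (Q : Fin np) →
            Unique (map (atX {nf = nf}) (P₁ ∷ Ps)) →
            IsAPSRule (rule (map (atX {nf = nf}) (P₁ ∷ Ps)) (atX Q))
  empty   : (Q : Fin np) → IsAPSRule (rule [] (oatom Q eps))

record APS (np nf : ℕ) : Set where
  constructor aps
  field
    rules     : List (Rule np nf)
    admissible : All IsAPSRule rules

APS-IS : {np nf : ℕ} → APS np nf → InferenceSystem np nf
APS-IS I r = r ∈ APS.rules I

{-# OPTIONS --safe #-}
-- Every closed term is either ε or a t, i.e. an instance of exactly one of the patterns ε and a x;
-- so the atoms P(ε) and P(a x) cover all closed atoms, each exactly once.  The conclusion of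
-- every rule of an alternating pushdown system is Q(ε), Q(a x) or Q(x); replacing each rule
-- with conclusion Q(x) by its instances x := ε and x := a x gives a system with the same
-- closed rule instances, hence the same provable atoms, and all of its conclusions are patterns.
module Submission where

open import Defs
open import Data.Nat using (ℕ)
open import Data.Fin using (Fin)
open import Data.List using (List; []; _∷_; map; concat; allFin)
open import Data.List.Relation.Unary.All using (All; []; _∷_; lookup)
open import Data.List.Relation.Unary.Any using (here; there)
open import Data.List.Membership.Propositional using (_∈_)
open import Data.List.Membership.Propositional.Properties
  using (∈-map⁺; ∈-map⁻; ∈-concat⁺′; ∈-concat⁻′; ∈-allFin)
open import Data.List.Properties using (map-cong; map-∘)
open import Data.Product using (Σ; _×_; _,_)
open import Data.Sum using (_⊎_; inj₁; inj₂)
open import Function using (_∘_)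
open import Relation.Binary.PropositionalEquality

module _ {np nf : ℕ} where

  conclusionArg : Rule np nf → OTerm nf
  conclusionArg r = OAtom.arg (Rule.conclusion r)

  InstanceOf : InferenceSystem np nf → CAtom np nf → List (CAtom np nf) → Set
  InstanceOf S A As =
    Σ (Rule np nf) λ r → S r × Σ (CTerm nf) λ t →
      substA (Rule.conclusion r) t ≡ A × map (λ B → substA B t) (Rule.premises r) ≡ As

  mutual
    Provable-⊆ : {S S' : InferenceSystem np nf} →
      (∀ {A As} → InstanceOf S A As → InstanceOf S' A As) →
      ∀ {A} → Provable S A → Provable S' A
    Provable-⊆ {S' = S'} sim (node r Sr t ps) with sim (r , Sr , t , refl , refl)
    ... | r' , S'r' , t' , conclusion≡ , premises≡ =
      subst (Provable S') conclusion≡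
        (node r' S'r' t' (subst (All (Provable S')) (sym premises≡) (All-Provable-⊆ sim ps)))

    All-Provable-⊆ : {S S' : InferenceSystem np nf} →
      (∀ {A As} → InstanceOf S A As → InstanceOf S' A As) →
      ∀ {As} → All (Provable S) As → All (Provable S') As
    All-Provable-⊆ sim []       = []
    All-Provable-⊆ sim (p ∷ ps) = Provable-⊆ sim p ∷ All-Provable-⊆ sim ps

  substO : OTerm nf → OTerm nf → OTerm nf
  substO var       p = p
  substO eps       p = eps
  substO (app a s) p = app a (substO s p)

  substT-substO : (s p : OTerm nf) (u : CTerm nf) →
    substT (substO s p) u ≡ substT s (substT p u)
  substT-substO var       p u = refl
  substT-substO eps       p u = refl
  substT-substO (app a s) p u = cong (app a) (substT-substO s p u)

  substOA : OAtom np nf → OTerm nf → OAtom np nf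
  substOA (oatom P s) p = oatom P (substO s p)

  substA-substOA : (B : OAtom np nf) (p : OTerm nf) (u : CTerm nf) →
    substA (substOA B p) u ≡ substA B (substT p u)
  substA-substOA (oatom P s) p u = cong (catom P) (substT-substO s p u)

  instantiate : Rule np nf → OTerm nf → Rule np nf
  instantiate (rule ps c) p = rule (map (λ B → substOA B p) ps) (substOA c p)

  premises-instantiate : (ps : List (OAtom np nf)) (p : OTerm nf) (u : CTerm nf) →
    map (λ A → substA A u) (map (λ B → substOA B p) ps) ≡ map (λ A → substA A (substT p u)) ps
  premises-instantiate ps p u = begin
    map (λ A → substA A u) (map (λ B → substOA B p) ps)  ≡⟨ map-∘ ps ⟨
    map (λ B → substA (substOA B p) u) ps                ≡⟨ map-cong (λ B → substA-substOA B p u) ps ⟩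
    map (λ A → substA A (substT p u)) ps                 ∎
    where open ≡-Reasoning

  instance-instantiate : {S : InferenceSystem np nf} (r : Rule np nf) (p : OTerm nf) (u : CTerm nf) →
    S r → InstanceOf S (substA (Rule.conclusion (instantiate r p)) u)
                       (map (λ A → substA A u) (Rule.premises (instantiate r p)))
  instance-instantiate (rule ps c) p u Sr =
    rule ps c , Sr , substT p u , sym (substA-substOA c p u) , sym (premises-instantiate ps p u)

  data Shallow : OTerm nf → Set where
    eps : Shallow eps
    app : (a : Fin nf) → Shallow (app a var)

  ShallowOrVar : OTerm nf → Set
  ShallowOrVar t = Shallow t ⊎ t ≡ var

  shallow-split : (t : CTerm nf) → Σ (OTerm nf) λ p → Shallow p × Σ (CTerm nf) λ u → substT p u ≡ t
  shallow-split ε         = eps , eps , ε , refl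
  shallow-split (app a t) = app a var , app a , t , refl

  shallow-unique : {p q : OTerm nf} → Shallow p → Shallow q →
    (u v : CTerm nf) → substT p u ≡ substT q v → p ≡ q
  shallow-unique eps     eps     u v _    = refl
  shallow-unique eps     (app b) u v ()
  shallow-unique (app a) eps     u v ()
  shallow-unique (app a) (app b) u v refl = refl

  patternsOf : Fin np → List (OAtom np nf)
  patternsOf P = oatom P eps ∷ map (λ a → oatom P (app a var)) (allFin nf)

  patterns : List (OAtom np nf)
  patterns = concat (map patternsOf (allFin np))

  ∈-patterns⁺ : (Q : Fin np) {t : OTerm nf} → Shallow t → oatom Q t ∈ patterns
  ∈-patterns⁺ Q eps     = ∈-concat⁺′ (here refl) (∈-map⁺ patternsOf (∈-allFin Q))
  ∈-patterns⁺ Q (app a) =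
    ∈-concat⁺′ (there (∈-map⁺ (λ a → oatom Q (app a var)) (∈-allFin a))) (∈-map⁺ patternsOf (∈-allFin Q))

  ∈-patterns⁻ : {B : OAtom np nf} → B ∈ patterns → Shallow (OAtom.arg B)
  ∈-patterns⁻ B∈ with ∈-concat⁻′ (map patternsOf (allFin np)) B∈
  ... | Bs , B∈Bs , Bs∈ with ∈-map⁻ patternsOf Bs∈
  ... | P , _ , refl with B∈Bs
  ... | here refl = eps
  ... | there B∈apps with ∈-map⁻ (λ a → oatom P (app a var)) B∈apps
  ... | a , _ , refl = app a

  unique-pattern : (A : CAtom np nf) → Σ (OAtom np nf) λ B →
    B ∈ patterns × IsInstance A B
    × ((B' : OAtom np nf) → B' ∈ patterns → IsInstance A B' → B' ≡ B)
  unique-pattern (catom P t) with shallow-split t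
  ... | p , shp , u , refl = oatom P p , ∈-patterns⁺ P shp , (u , refl) , unique
    where
    unique : (B' : OAtom np nf) → B' ∈ patterns → IsInstance (catom P (substT p u)) B' →
             B' ≡ oatom P p
    unique (oatom P' q) B'∈ (v , instance≡) =
      cong₂ oatom (cong CAtom.pred instance≡)
                  (shallow-unique (∈-patterns⁻ B'∈) shp v u (cong CAtom.arg instance≡))

  data Refines : Rule np nf → Rule np nf → Set where
    keep  : {r : Rule np nf} → Shallow (conclusionArg r) → Refines r r
    split : {r : Rule np nf} {p : OTerm nf} → Shallow p → conclusionArg r ≡ var →
            Refines r (instantiate r p)

  refinement : InferenceSystem np nf → InferenceSystem np nf
  refinement S r' = Σ (Rule np nf) λ r → S r × Refines r r'

  refinement⇒original : {S : InferenceSystem np nf} {A : CAtom np nf} {As : List (CAtom np nf)} →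
    InstanceOf (refinement S) A As → InstanceOf S A As
  refinement⇒original (r , (.r , Sr , keep _) , t , conclusion≡ , premises≡) =
    r , Sr , t , conclusion≡ , premises≡
  refinement⇒original (_ , (r , Sr , split {p = p} _ _) , u , refl , refl) =
    instance-instantiate r p u Sr

  original⇒refinement : {S : InferenceSystem np nf} →
    (∀ {r} → S r → ShallowOrVar (conclusionArg r)) →
    {A : CAtom np nf} {As : List (CAtom np nf)} → InstanceOf S A As → InstanceOf (refinement S) A As
  original⇒refinement shape (r , Sr , t , conclusion≡ , premises≡) with shape Sr
  ... | inj₁ shallow = r , (r , Sr , keep shallow) , t , conclusion≡ , premises≡
  ... | inj₂ isVar with shallow-split t | r
  ... | p , shp , u , refl | rule ps (oatom Q var) =
    instantiate (rule ps (oatom Q var)) p , (rule ps (oatom Q var) , Sr , split shp isVar) , u ,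
    conclusion≡ , trans (premises-instantiate ps p u) premises≡

  refinement-equivalent : {S : InferenceSystem np nf} →
    (∀ {r} → S r → ShallowOrVar (conclusionArg r)) →
    Equivalent S (refinement S)
  refinement-equivalent shape A =
    Provable-⊆ (original⇒refinement shape) , Provable-⊆ refinement⇒original

  refinement-conclusions : {S : InferenceSystem np nf} (r : Rule np nf) →
    refinement S r → Rule.conclusion r ∈ patterns
  refinement-conclusions r (.r , _ , keep shallow) = ∈-patterns⁺ _ shallow
  refinement-conclusions _ (rule _ (oatom Q var) , _ , split shp refl) = ∈-patterns⁺ Q shp

  APS-conclusionArg : {r : Rule np nf} → IsAPSRule r → ShallowOrVar (conclusionArg r)
  APS-conclusionArg (intro _ _ a _)   = inj₁ (app a)
  APS-conclusionArg (elim _ _ _ _ _)  = inj₂ refl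
  APS-conclusionArg (arbitrary _)     = inj₂ refl
  APS-conclusionArg (neutral _ _ _ _) = inj₂ refl
  APS-conclusionArg (empty _)         = inj₁ eps

lemma5 : (np nf : ℕ) (I : APS np nf) →
    Σ (InferenceSystem np nf) λ Î →
    Σ (List (OAtom np nf)) λ C →
      Equivalent (APS-IS I) Î
      × ((r : Rule np nf) → Î r → Rule.conclusion r ∈ C)
      × ((A : CAtom np nf) →
           Σ (OAtom np nf) λ B →
             B ∈ C × IsInstance A B
             × ((B' : OAtom np nf) → B' ∈ C → IsInstance A B' → B' ≡ B))
lemma5 np nf I =
  refinement (APS-IS I) , patterns ,
  refinement-equivalent (APS-conclusionArg ∘ lookup (APS.admissible I)) ,
  refinement-conclusions , unique-pattern
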